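{- Let $L$ be a diamond with least element $0$ and greatest element $1$, let $\alpha\in L$, and let $G$ be a finite $MH$-homogeneous vertex-uniform $L$-colored graph in which every vertex has color $\alpha$. Assume there exist $x_0,y_0\in V(G)$ with $\chi(x_0,y_0)=1$. Then there exists a positive integer $n$ such that every connected component of $G$ is isomorphic to $U(n,\alpha,1)$.
   Context: A diamond is a poset consisting of a set of pairwise incomparable elements together with a least element $0$ and a greatest element $1$. For a poset $L$ with order $\preceq$, least element $0$ and greatest element $1$: an $L$-colored graph is a triple $G=(V,\chi',\chi'')$ where $V$ is nonempty, $\chi':V\to L$ is arbitrary and $\chi'':V^2\to L$ satisfies $\chi''(x,x)=0$ and $\chi''(x,y)=\chi''(y,x)$. Write $\chi(x)=\chi'(x)$, $\chi(x,y)=\chi''(x,y)$, $V(G)=V$, and $G[W]=(W,\chi'|_W,\chi''|_{W^2})$ for $W\subseteq V$. A homomorphism between $L$-colored graphs is a map $f$ of vertex sets with $\chi_1(x)\preceq\chi_2(f(x))$ and $\chi_1(x,y)\preceq\chi_2(f(x),f(y))$ for all $x,y$; monomorphism = injective homomorphism; endomorphism = homomorphism $G\to G$; isomorphism = bijection preserving vertex and edge colors exactly. $G$ is $MH$-homogeneous if every monomorphism from $G[S]$ to $G[T]$, for finite $S,T\subseteq V$, extends to an endomorphism of $G$. $G$ is vertex-uniform if all vertices have the same color. Connected components of $G$ are the equivalence classes (viewed as induced substructures) of the reflexive transitive closure of $\{(x,y):\chi(x,y)\ne0\}$. $U(n,\alpha,\beta)$ ($\beta\succ 0$) is the $L$-colored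 graph on $n$ vertices with all vertices colored $\alpha$ and all edges between distinct vertices colored $\beta$. -}

module Defs where

open import Data.Nat using (ℕ)
open import Data.Fin using (Fin; _≟_)
open import Data.Fin.Subset using (Subset; _∈_)
open import Data.Product using (Σ; _×_; _,_)
open import Relation.Binary.PropositionalEquality using (_≡_; _≢_)
open import Relation.Nullary using (¬_; yes; no)
open import Relation.Binary.Construct.Closure.ReflexiveTransitive using (Star)

data Diamond (A : Set) : Set where
  ⊥L  : Diamond A
  ⊤L  : Diamond A
  mid : A → Diamond A

data _≼_ {A : Set} : Diamond A → Diamond A → Set where
  ⊥≼   : ∀ {x} → ⊥L ≼ x
  ≼⊤   : ∀ {x} → x ≼ ⊤L
  mid≼ : ∀ {a} → mid a ≼ mid a

record ColGraph (A : Set) (m : ℕ) : Set where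
  field
    vcol    : Fin m → Diamond A
    ecol    : Fin m → Fin m → Diamond A
    ecol-refl : ∀ x → ecol x x ≡ ⊥L
    ecol-sym  : ∀ x y → ecol x y ≡ ecol y x
open ColGraph public

IsHom : ∀ {A m k} → ColGraph A m → ColGraph A k → (Fin m → Fin k) → Set
IsHom G H f =
  (∀ x → vcol G x ≼ vcol H (f x)) ×
  (∀ x y → ecol G x y ≼ ecol H (f x) (f y))

-- MH-homogeneity: every monomorphism G[S] → G[T] (S, T finite subsets of V)
-- extends to an endomorphism of G.  A map G[S] → G[T] is given as a
-- function on the elements of S with values in T.
MH-homogeneous : ∀ {A m} → ColGraph A m → Set
MH-homogeneous {A} {m} G =
  (S T : Subset m) (f : (x : Fin m) → x ∈ S → Fin m) →
  (∀ x p → f x p ∈ T) →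
  (∀ x p y q → f x p ≡ f y q → x ≡ y) →
  (∀ x p → vcol G x ≼ vcol G (f x p)) →
  (∀ x p y q → ecol G x y ≼ ecol G (f x p) (f y q)) →
  Σ (Fin m → Fin m) λ g → IsHom G G g × (∀ x p → g x ≡ f x p)

-- Vertex-uniform with every vertex colored α.
AllVerticesColored : ∀ {A m} → ColGraph A m → Diamond A → Set
AllVerticesColored G α = ∀ x → vcol G x ≡ α

Adj : ∀ {A m} → ColGraph A m → Fin m → Fin m → Set
Adj G x y = ecol G x y ≢ ⊥L

Connected : ∀ {A m} → ColGraph A m → Fin m → Fin m → Set
Connected G = Star (Adj G)

U-ecol : ∀ {A n} → Diamond A → Fin n → Fin n → Diamond A
U-ecol β i j with i ≟ j
... | yes _ = ⊥L
... | no  _ = β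

ComponentIsoU : ∀ {A m} → ColGraph A m → Fin m → ℕ → Diamond A → Diamond A → Set
ComponentIsoU {A} {m} G x n α β =
  Σ (Fin n → Fin m) λ h →
    (∀ i j → h i ≡ h j → i ≡ j) ×
    (∀ i → Connected G x (h i)) ×
    (∀ y → Connected G x y → Σ (Fin n) λ i → h i ≡ y) ×
    (∀ i → vcol G (h i) ≡ α) ×
    (∀ i j → ecol G (h i) (h j) ≡ U-ecol β i j)

-- Call an edge with colour ⊤L full.  By vertex-uniformity every partial
-- injection that does not lower edge colours is a monomorphism, so MH-homogeneity
-- provides endomorphisms that move one vertex a to b while fixing a chosen set P.
-- Choosing P as a set of full neighbours shows (1) full edges are transitive on
-- distinct vertices and (2) every non-full edge is ⊥L: otherwise the endomorphism
-- would send some y to a full neighbour of y that it fixes, creating a full loop.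
-- So the components are cliques of full edges, and the endomorphism sending a
-- vertex of one component to a vertex of another embeds the first component into
-- the second, whence all components have the same size.
module Submission where

open import Defs
open import Level using (0ℓ)
open import Data.Nat using (ℕ; _≥_; _≤_)
open import Data.Nat.Properties using (≤-antisym)
open import Data.Fin using (Fin; zero; suc; _≟_)
open import Data.Fin.Properties using (injective⇒≤)
open import Data.Fin.Subset using (Subset; ⊤) renaming (_∈_ to _∈ₛ_)
open import Data.Fin.Subset.Properties using (∈⊤)
open import Data.Vec using (tabulate)
open import Data.Vec.Properties using (lookup∘tabulate; lookup⇒[]=; []=⇒lookup)
open import Data.Bool.Properties using (T-≡)
open import Data.List using (List; _∷_; length; lookup; filter; allFin)
open import Data.List.Membership.Propositional using (_∈_)
open import Data.List.Membership.Propositional.Properties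
  using (∈-lookup; ∈-filter⁺; ∈-filter⁻; ∈-allFin; ∈-length)
import Data.List.Relation.Unary.Any as Any
open import Data.List.Relation.Unary.Any.Properties using (lookup-index)
import Data.List.Relation.Unary.All as All
open import Data.List.Relation.Unary.AllPairs using (_∷_)
open import Data.List.Relation.Unary.Unique.Propositional using (Unique)
open import Data.List.Relation.Unary.Unique.Propositional.Properties using (filter⁺; allFin⁺)
open import Data.Product using (Σ; _×_; _,_; proj₂)
open import Data.Sum using (_⊎_; inj₁; inj₂)
open import Data.Empty using (⊥-elim)
open import Function using (_∘_)
open import Function.Bundles using (Equivalence)
open import Function.Definitions using (Injective)
open import Relation.Nullary using (¬_; Dec; yes; no)
open import Relation.Nullary.Decidable using (isYes; toWitness; fromWitness; decidable-stable; _⊎-dec_; _×-dec_)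
open import Relation.Unary using (Pred; Decidable; ∅)
open import Relation.Unary.Properties using (∅?)
open import Relation.Binary.PropositionalEquality
open import Relation.Binary.Construct.Closure.ReflexiveTransitive using (ε; _◅_)

module _ {a} {A : Set a} where

  lookup-injective : ∀ {xs : List A} → Unique xs → Injective _≡_ _≡_ (lookup xs)
  lookup-injective (_   ∷ _) {zero}  {zero}  _  = refl
  lookup-injective (x∉xs ∷ _) {zero}  {suc j} eq = ⊥-elim (All.lookup x∉xs (∈-lookup j) eq)
  lookup-injective (x∉xs ∷ _) {suc i} {zero}  eq = ⊥-elim (All.lookup x∉xs (∈-lookup i) (sym eq))
  lookup-injective (_   ∷ u) {suc i} {suc j} eq = cong suc (lookup-injective u eq)

  injection⇒length≤ : ∀ {b} {B : Set b} {xs : List A} {ys : List B} → Unique xs →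
    (f : A → B) → (∀ {x} → x ∈ xs → f x ∈ ys) →
    (∀ {x y} → x ∈ xs → y ∈ xs → f x ≡ f y → x ≡ y) →
    length xs ≤ length ys
  injection⇒length≤ {xs = xs} {ys} unique f maps-to injective-on = injective⇒≤ F-injective
    where
    F : Fin (length xs) → Fin (length ys)
    F i = Any.index (maps-to (∈-lookup i))

    F-injective : Injective _≡_ _≡_ F
    F-injective {i} {j} Fi≡Fj = lookup-injective unique
      (injective-on (∈-lookup i) (∈-lookup j) (begin
        f (lookup xs i)  ≡⟨ lookup-index (maps-to (∈-lookup i)) ⟩
        lookup ys (F i)  ≡⟨ cong (lookup ys) Fi≡Fj ⟩
        lookup ys (F j)  ≡⟨ lookup-index (maps-to (∈-lookup j)) ⟨
        f (lookup xs j)  ∎))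
      where open ≡-Reasoning

module _ {m} {P : Pred (Fin m) 0ℓ} (P? : Decidable P) where

  fromDecidable : Subset m
  fromDecidable = tabulate (isYes ∘ P?)

  ∈-fromDecidable⁺ : ∀ {x} → P x → x ∈ₛ fromDecidable
  ∈-fromDecidable⁺ {x} px = lookup⇒[]= x _
    (trans (lookup∘tabulate (isYes ∘ P?) x) (Equivalence.to T-≡ (fromWitness px)))

  ∈-fromDecidable⁻ : ∀ {x} → x ∈ₛ fromDecidable → P x
  ∈-fromDecidable⁻ {x} x∈ = toWitness (Equivalence.from T-≡
    (trans (sym (lookup∘tabulate (isYes ∘ P?) x)) ([]=⇒lookup x∈)))

module _ {A : Set} where

  ≼-refl : (c : Diamond A) → c ≼ c
  ≼-refl ⊥L      = ⊥≼
  ≼-refl ⊤L      = ≼⊤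
  ≼-refl (mid _) = mid≼

  ≼-≡⊤ : ∀ {c d : Diamond A} → d ≡ ⊤L → c ≼ d
  ≼-≡⊤ refl = ≼⊤

  ⊤≼⇒≡⊤ : ∀ {c : Diamond A} → ⊤L ≼ c → c ≡ ⊤L
  ⊤≼⇒≡⊤ ≼⊤ = refl

  ≼⊥⇒≡⊥ : ∀ {c : Diamond A} → c ≼ ⊥L → c ≡ ⊥L
  ≼⊥⇒≡⊥ ⊥≼ = refl

  _≟⊤ : (c : Diamond A) → Dec (c ≡ ⊤L)
  ⊥L    ≟⊤ = no λ ()
  ⊤L    ≟⊤ = yes refl
  mid _ ≟⊤ = no λ ()

module _ {A : Set} {m : ℕ} (G : ColGraph A m) (mh : MH-homogeneous G) where

  extend : ∀ {P : Pred (Fin m) 0ℓ} → Decidable P → (f : Fin m → Fin m) →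
    (∀ {x y} → P x → P y → f x ≡ f y → x ≡ y) →
    (∀ {x} → P x → vcol G x ≼ vcol G (f x)) →
    (∀ {x y} → P x → P y → ecol G x y ≼ ecol G (f x) (f y)) →
    Σ (Fin m → Fin m) λ g → IsHom G G g × (∀ {x} → P x → g x ≡ f x)
  extend P? f injective-on vcol-≼ ecol-≼
    with g , hom , g≡f ← mh (fromDecidable P?) ⊤ (λ x _ → f x) (λ _ _ → ∈⊤)
           (λ _ p _ q → injective-on (∈-fromDecidable⁻ P? p) (∈-fromDecidable⁻ P? q))
           (λ _ p → vcol-≼ (∈-fromDecidable⁻ P? p))
           (λ _ p _ q → ecol-≼ (∈-fromDecidable⁻ P? p) (∈-fromDecidable⁻ P? q))
    = g , hom , λ px → g≡f _ (∈-fromDecidable⁺ P? px)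

redirect : ∀ {m} → Fin m → Fin m → Fin m → Fin m
redirect a b w with w ≟ a
... | yes _ = b
... | no  _ = w

redirect-hit : ∀ {m} (a b : Fin m) → redirect a b a ≡ b
redirect-hit a b with a ≟ a
... | yes _   = refl
... | no  a≢a = ⊥-elim (a≢a refl)

redirect-miss : ∀ {m} {a b w : Fin m} → w ≢ a → redirect a b w ≡ w
redirect-miss {a = a} {w = w} w≢a with w ≟ a
... | yes w≡a = ⊥-elim (w≢a w≡a)
... | no  _   = refl

module VertexUniform {A : Set} {m : ℕ} (G : ColGraph A m) (α : Diamond A)
  (mh : MH-homogeneous G) (uniform : AllVerticesColored G α) where

  move : ∀ {P : Pred (Fin m) 0ℓ} → Decidable P → (a b : Fin m) →
    (∀ {w} → P w → w ≢ a) → (∀ {w} → P w → w ≢ b) →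
    (∀ {w} → P w → ecol G a w ≼ ecol G b w) →
    Σ (Fin m → Fin m) λ g → IsHom G G g × g a ≡ b × (∀ {w} → P w → g w ≡ w)
  move {P} P? a b a∉P b∉P raises
    = let g , hom , g≡f = extend G mh Q? f injective-on (λ _ → vcol-≼) ecol-≼
      in g , hom , trans (g≡f (inj₁ refl)) fa≡b , λ pw → trans (g≡f (inj₂ pw)) (fw≡w pw)
    where
    Q : Pred (Fin m) 0ℓ
    Q w = w ≡ a ⊎ P w

    Q? : Decidable Q
    Q? w = (w ≟ a) ⊎-dec P? w

    f : Fin m → Fin m
    f = redirect a b

    fa≡b : f a ≡ b
    fa≡b = redirect-hit a b

    fw≡w : ∀ {w} → P w → f w ≡ w
    fw≡w pw = redirect-miss (a∉P pw)

    injective-on : ∀ {x y} → Q x → Q y → f x ≡ f y → x ≡ y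
    injective-on (inj₁ refl) (inj₁ refl) _  = refl
    injective-on (inj₁ refl) (inj₂ py)   eq =
      ⊥-elim (b∉P py (trans (sym (fw≡w py)) (trans (sym eq) fa≡b)))
    injective-on (inj₂ px)   (inj₁ refl) eq = sym (injective-on (inj₁ refl) (inj₂ px) (sym eq))
    injective-on (inj₂ px)   (inj₂ py)   eq = trans (sym (fw≡w px)) (trans eq (fw≡w py))

    vcol-≼ : ∀ {x y} → vcol G x ≼ vcol G y
    vcol-≼ {x} {y} = subst₂ _≼_ (sym (uniform x)) (sym (uniform y)) (≼-refl α)

    ecol-≼ : ∀ {x y} → Q x → Q y → ecol G x y ≼ ecol G (f x) (f y)
    ecol-≼ (inj₁ refl) (inj₁ refl) = subst (_≼ ecol G (f a) (f a)) (sym (ecol-refl G a)) ⊥≼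
    ecol-≼ (inj₁ refl) (inj₂ py) rewrite fa≡b | fw≡w py = raises py
    ecol-≼ {x = x} (inj₂ px) (inj₁ refl) rewrite fa≡b | fw≡w px =
      subst₂ _≼_ (ecol-sym G a x) (ecol-sym G b x) (raises px)
    ecol-≼ (inj₂ px) (inj₂ py) rewrite fw≡w px | fw≡w py = ≼-refl _

  transport : ∀ x y → Σ (Fin m → Fin m) λ g → IsHom G G g × g x ≡ y
  transport x y =
    let g , hom , gx≡y , _ = move ∅? x y (λ ()) (λ ()) (λ ())
    in g , hom , gx≡y

  infix 4 _~_
  _~_ : Fin m → Fin m → Set
  x ~ y = ecol G x y ≡ ⊤L

  ~-sym : ∀ {x y} → x ~ y → y ~ x
  ~-sym {x} {y} x~y = trans (ecol-sym G y x) x~y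

  ~-irrefl : ∀ {x} → ¬ x ~ x
  ~-irrefl {x} x~x with () ← trans (sym (ecol-refl G x)) x~x

  ~⇒≢ : ∀ {x y} → x ~ y → x ≢ y
  ~⇒≢ x~x refl = ~-irrefl x~x

  IsHom⇒~-preserving : ∀ {g} → IsHom G G g → ∀ {x y} → x ~ y → g x ~ g y
  IsHom⇒~-preserving {g} (_ , preserves) {x} {y} x~y =
    ⊤≼⇒≡⊤ (subst (_≼ ecol G (g x) (g y)) x~y (preserves x y))

  image-of-~-not-fixed : ∀ {g u} → IsHom G G g → u ~ g u → g (g u) ≢ g u
  image-of-~-not-fixed hom u~gu gu-fixed = ~⇒≢ (IsHom⇒~-preserving hom u~gu) (sym gu-fixed)

  -- Move z to y fixing x and the common full neighbours of x and y; then g y is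
  -- such a common neighbour, hence fixed, although y ~ g y.
  ~-trans : ∀ {x y z} → x ~ y → y ~ z → x ≢ z → x ~ z
  ~-trans {x} {y} {z} x~y y~z x≢z = decidable-stable (ecol G x z ≟⊤) λ x≁z →
    let g , hom , gz≡y , fixes = move P? z y (z∉P x≁z) y∉P raises
        gx≡x = fixes (inj₁ refl)
        x~gy = subst (_~ g y) gx≡x (IsHom⇒~-preserving hom x~y)
        y~gy = subst (_~ g y) gz≡y (IsHom⇒~-preserving hom (~-sym y~z))
    in image-of-~-not-fixed hom y~gy (fixes (inj₂ (x~gy , y~gy)))
    where
    P : Pred (Fin m) 0ℓ
    P w = w ≡ x ⊎ (x ~ w × y ~ w)

    P? : Decidable P
    P? w = (w ≟ x) ⊎-dec ((ecol G x w ≟⊤) ×-dec (ecol G y w ≟⊤))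

    z∉P : ¬ x ~ z → ∀ {w} → P w → w ≢ z
    z∉P _   (inj₁ refl)       = x≢z
    z∉P x≁z (inj₂ (x~w , _)) refl = x≁z x~w

    y∉P : ∀ {w} → P w → w ≢ y
    y∉P (inj₁ refl)      = ~⇒≢ x~y
    y∉P (inj₂ (_ , y~w)) = ~⇒≢ (~-sym y~w)

    raises : ∀ {w} → P w → ecol G z w ≼ ecol G y w
    raises (inj₁ refl)      = ≼-≡⊤ (~-sym x~y)
    raises (inj₂ (_ , y~w)) = ≼-≡⊤ y~w

  module WithFullEdge (x₀ y₀ : Fin m) (x₀~y₀ : x₀ ~ y₀) where

    full-neighbour : ∀ u → Σ (Fin m) (u ~_)
    full-neighbour u =
      let g , hom , gx₀≡u = transport x₀ u
      in g y₀ , subst (_~ g y₀) gx₀≡u (IsHom⇒~-preserving hom x₀~y₀)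

    -- Move v to u fixing the full neighbours of u.  Then g u = u, as otherwise
    -- g u would be a fixed full neighbour of u; so ecol u v ≼ ecol u u = ⊥L.
    ≁⇒⊥ : ∀ {u v} → u ≢ v → ¬ u ~ v → ecol G u v ≡ ⊥L
    ≁⇒⊥ {u} {v} u≢v u≁v =
      let g , hom , gv≡u , fixes = move P? v u v∉P u∉P raises
          gu≡u = decidable-stable (g u ≟ u) λ gu≢u →
            let w , u~w = full-neighbour u
                gu~w = subst (g u ~_) (fixes u~w) (IsHom⇒~-preserving hom u~w)
                u~gu = ~-sym (~-trans gu~w (~-sym u~w) gu≢u)
            in image-of-~-not-fixed hom u~gu (fixes u~gu)
      in ≼⊥⇒≡⊥ (subst (ecol G u v ≼_)
           (trans (cong₂ (ecol G) gu≡u gv≡u) (ecol-refl G u)) (proj₂ hom u v))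
      where
      P : Pred (Fin m) 0ℓ
      P w = u ~ w

      P? : Decidable P
      P? w = ecol G u w ≟⊤

      v∉P : ∀ {w} → P w → w ≢ v
      v∉P u~w refl = u≁v u~w

      u∉P : ∀ {w} → P w → w ≢ u
      u∉P u~w = ~⇒≢ (~-sym u~w)

      raises : ∀ {w} → P w → ecol G v w ≼ ecol G u w
      raises = ≼-≡⊤

    Adj⇒~ : ∀ {x y} → Adj G x y → x ~ y
    Adj⇒~ {x} x-y = decidable-stable (_ ≟⊤) λ x≁y →
      x-y (≁⇒⊥ (λ { refl → x-y (ecol-refl G x) }) x≁y)

    Component : Fin m → Fin m → Set
    Component x y = x ≡ y ⊎ x ~ y

    component? : ∀ x → Decidable (Component x)
    component? x y = (x ≟ y) ⊎-dec (ecol G x y ≟⊤)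

    component-sym : ∀ {x y} → Component x y → Component y x
    component-sym (inj₁ refl) = inj₁ refl
    component-sym (inj₂ x~y)  = inj₂ (~-sym x~y)

    component-trans : ∀ {x y z} → Component x y → Component y z → Component x z
    component-trans (inj₁ refl) y-z         = y-z
    component-trans (inj₂ x~y)  (inj₁ refl) = inj₂ x~y
    component-trans {x} {z = z} (inj₂ x~y) (inj₂ y~z) with x ≟ z
    ... | yes x≡z = inj₁ x≡z
    ... | no  x≢z = inj₂ (~-trans x~y y~z x≢z)

    component-clique : ∀ {x y z} → Component x y → Component x z → y ≢ z → y ~ z
    component-clique x-y x-z y≢z with component-trans (component-sym x-y) x-z
    ... | inj₁ y≡z = ⊥-elim (y≢z y≡z)
    ... | inj₂ y~z = y~z

    Connected⇒Component : ∀ {x y} → Connected G x y → Component x y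
    Connected⇒Component ε             = inj₁ refl
    Connected⇒Component (x-y ◅ y⋯z) = component-trans (inj₂ (Adj⇒~ x-y)) (Connected⇒Component y⋯z)

    Component⇒Connected : ∀ {x y} → Component x y → Connected G x y
    Component⇒Connected (inj₁ refl) = ε
    Component⇒Connected (inj₂ x~y)  = (λ x-y≡⊥ → ⊤≢⊥ (trans (sym x~y) x-y≡⊥)) ◅ ε
      where ⊤≢⊥ : ⊤L ≢ ⊥L
            ⊤≢⊥ ()

    members : Fin m → List (Fin m)
    members x = filter (component? x) (allFin m)

    members-unique : ∀ x → Unique (members x)
    members-unique x = filter⁺ (component? x) (allFin⁺ m)

    ∈-members⁺ : ∀ {x y} → Component x y → y ∈ members x
    ∈-members⁺ {x} {y} = ∈-filter⁺ (component? x) (∈-allFin y)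

    ∈-members⁻ : ∀ {x y} → y ∈ members x → Component x y
    ∈-members⁻ {x} y∈ = proj₂ (∈-filter⁻ (component? x) {xs = allFin m} y∈)

    members-length-≤ : ∀ x y → length (members x) ≤ length (members y)
    members-length-≤ x y =
      let g , hom , gx≡y = transport x y
          image : ∀ {z} → Component x z → Component y (g z)
          image = λ where
            (inj₁ refl) → inj₁ (sym gx≡y)
            (inj₂ x~z)  → inj₂ (subst (_~ g _) gx≡y (IsHom⇒~-preserving hom x~z))
      in injection⇒length≤ (members-unique x) g
           (∈-members⁺ ∘ image ∘ ∈-members⁻)
           (λ {z₁} {z₂} z₁∈ z₂∈ gz₁≡gz₂ → decidable-stable (z₁ ≟ z₂) λ z₁≢z₂ →
             ~⇒≢ (IsHom⇒~-preserving hom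
               (component-clique (∈-members⁻ z₁∈) (∈-members⁻ z₂∈) z₁≢z₂)) gz₁≡gz₂)

    component≅U : ∀ x {n} → n ≡ length (members x) → ComponentIsoU G x n α ⊤L
    component≅U x refl =
      lookup (members x) , (λ _ _ → injective) ,
      (λ i → Component⇒Connected (∈-members⁻ (∈-lookup i))) ,
      (λ y x⋯y → let y∈ = ∈-members⁺ (Connected⇒Component x⋯y)
                 in Any.index y∈ , sym (lookup-index y∈)) ,
      (λ i → uniform _) ,
      edges
      where
      injective : Injective _≡_ _≡_ (lookup (members x))
      injective = lookup-injective (members-unique x)

      edges : ∀ i j → ecol G (lookup (members x) i) (lookup (members x) j) ≡ U-ecol ⊤L i j
      edges i j with i ≟ j
      ... | yes refl = ecol-refl G _
      ... | no  i≢j  = component-clique (∈-members⁻ (∈-lookup i)) (∈-members⁻ (∈-lookup j))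
                         (i≢j ∘ injective)

mainTheorem8 : {A : Set} {m : ℕ} (G : ColGraph A m) (α : Diamond A) →
    MH-homogeneous G →
    AllVerticesColored G α →
    Σ (Fin m) (λ x₀ → Σ (Fin m) (λ y₀ → ecol G x₀ y₀ ≡ ⊤L)) →
    Σ ℕ (λ n → (n ≥ 1) × (∀ x → ComponentIsoU G x n α ⊤L))
mainTheorem8 G α mh uniform (x₀ , y₀ , x₀~y₀) =
  length (members x₀) ,
  ∈-length (∈-members⁺ (inj₁ refl)) ,
  λ x → component≅U x (≤-antisym (members-length-≤ x₀ x) (members-length-≤ x x₀))
  where open VertexUniform G α mh uniform
        open WithFullEdge x₀ y₀ x₀~y₀
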